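{- Let $p$ be a prime. Let $X_1, \dots, X_k$, $Y_1, \dots, Y_k$ and $Z$ be subsets of $\mathbb{Z}_p$ and let $1 \leq c_1^i \leq |X_i|$ and $1 \leq c_2^i \leq |Y_i|$ ($1\le i\le k$) be integers such that for all $i$ we have $c_1^ic_2^i\geq 16|X_i|$. Suppose that for all $i$ we have $16|X_i| \le |Y_i|$, $16|Z|\leq |Y_i|$ and $|Y_i| <p/2$. Then there exist $X'_i \in (X_i)^{(c_1^i)}$ and $Y'_i \in (Y_i)^{(c_2^i)}$ (for each $i$) such that $$\Big|\bigcup_i(X'_i+Y'_i)\setminus Z\Big| \geq \min\Big(\tfrac{1}{16}|Y_1|, \dots, \tfrac{1}{16}|Y_k|,\ 2\sum_i|X_i|\Big).$$
   Context: For a finite set $S$ and integer $m$, $S^{(m)}$ denotes the family of all $m$-element subsets of $S$. $X'_i+Y'_i$ denotes the sumset. -}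

module Defs where

open import Data.Nat using (ℕ; zero; suc; _+_; _*_; _⊓_)
open import Data.Nat.DivMod using (_mod_)
open import Data.Fin using (Fin; toℕ)
open import Data.Fin.Properties using (any?; _≟_)
open import Data.Fin.Subset using (Subset; _∈_; ⋃; ∣_∣)
open import Data.Fin.Subset.Properties using (_∈?_)
open import Data.Product using (∃; _×_; _,_)
open import Data.Vec using (tabulate)
open import Data.List using (List; foldr)
open import Data.Nat.ListAction using (sum)
import Data.List as List
open import Relation.Nullary.Decidable using (⌊_⌋; _×-dec_)
open import Relation.Binary.PropositionalEquality using (_≡_)

-- addition in ℤ_p, represented as Fin p (residues 0,…,p-1)
_+ₚ_ : ∀ {p} → Fin p → Fin p → Fin p
_+ₚ_ {suc n} x y = (toℕ x + toℕ y) mod (suc n)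

sumset : ∀ {p} → Subset p → Subset p → Subset p
sumset X Y = tabulate λ z →
  ⌊ any? (λ x → any? (λ y → (x ∈? X) ×-dec ((y ∈? Y) ×-dec ((x +ₚ y) ≟ z)))) ⌋

⋃ᵢ : ∀ {p k} → (Fin k → Subset p) → Subset p
⋃ᵢ {k = k} A = ⋃ (List.tabulate {n = k} A)

Σᵢ : ∀ {k} → (Fin k → ℕ) → ℕ
Σᵢ {k} f = sum (List.tabulate {n = k} f)

minᵢ : ∀ {k} → ℕ → (Fin k → ℕ) → ℕ
minᵢ {k} a f = foldr _⊓_ a (List.tabulate {n = k} f)

-- Fix a pair (A, Y) and a set W ⊆ ℤ_p of points already covered. Summed over all y ∈ ℤ_p, the
-- number of x ∈ A with x + y ∈ W is exactly |A||W|, so when 2|W| < |Y| some y ∈ Y translates at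
-- least half of A outside W. Choosing such y greedily, each new element of Y′ adds at least |A|/2
-- points to (A + Y′) ∖ W, until W ∪ (A + Y′) has half the size of Y. For |A| = c₁ and |Y′| = c₂,
-- c₁c₂ ≥ 16|X| then means that each pair either adds 2|X| new points or already reaches the
-- target |Y|/16; the pairs are processed in turn, each sumset joining W.

module Submission where

open import Defs
open import Data.Bool using (Bool; true; false; _∧_; not)
open import Data.Bool.Properties using (T-≡; ∧-zeroʳ; ∧-identityʳ)
open import Data.Empty using (⊥-elim)
open import Data.Nat using (ℕ; zero; suc; _+_; _*_; _∸_; _⊓_; _≤_; _<_; _≤?_; z≤n; s≤s; NonZero)
open import Data.Nat.Properties hiding (_≟_)
open import Data.Nat.DivMod using (_%_; _mod_; %-distribˡ-+; m%n%n≡m%n; n%n≡0; m<n⇒m%n≡m)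
open import Data.Nat.Primality using (Prime; prime⇒nonZero)
open import Data.Fin using (Fin; zero; suc; toℕ)
open import Data.Fin.Properties using (toℕ-fromℕ<; toℕ-injective; toℕ<n; any?; _≟_; ∀-cons)
open import Data.Fin.Permutation using (Permutation′; permutation)
open import Data.Fin.Subset using (Subset; _∈_; _⊆_; _∪_; _─_; ⁅_⁆; ∣_∣) renaming (⊥ to ∅)
open import Data.Fin.Subset.Properties
  using (_∈?_; ⊥⊆; ∣⊥∣≡0; ⊆-refl; ⊆-antisym; drop-∷-⊆; out⊆; in⊆in; p⊆q⇒∣p∣≤∣q∣;
         p⊆p∪q; q⊆p∪q; x∈p∪q⁻; x∈p∪q⁺; x∈⁅x⁆; x∈⁅y⁆⇒x≡y; ∣⁅x⁆∣≡1; ∪-assoc; p─q⊆p)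
open import Data.Product using (Σ; ∃; _×_; _,_; proj₂)
open import Data.Sum using (_⊎_; inj₁; inj₂; [_,_]′; map₂) renaming (map to ⊎-map)
open import Data.Vec using ([]; _∷_; lookup; here)
open import Data.Vec.Properties using ([]=⇒lookup; lookup⇒[]=; lookup∘tabulate)
import Data.Vec.Functional as Vector
open import Function using (_∘_; id)
open import Function.Bundles using (Equivalence)
open import Algebra.Properties.Semiring.Sum +-*-semiring
  using (sum-syntax; sum-cong-≗; ∑-permute; ∑-comm; ∑-distrib-+; *-distribˡ-sum; *-distribʳ-sum)
open import Relation.Nullary using (Dec; yes; no; contradiction)
open import Relation.Nullary.Decidable using (⌊_⌋; _×-dec_; toWitness; fromWitness)
open import Relation.Binary.PropositionalEquality

χ : Bool → ℕ
χ true = 1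
χ false = 0

∣p∣≡∑χ : ∀ {m} (S : Subset m) → ∣ S ∣ ≡ ∑[ i < m ] χ (lookup S i)
∣p∣≡∑χ [] = refl
∣p∣≡∑χ (true ∷ S) = cong suc (∣p∣≡∑χ S)
∣p∣≡∑χ (false ∷ S) = ∣p∣≡∑χ S

∑-mono-≤ : ∀ {m} {f g : Fin m → ℕ} → (∀ i → f i ≤ g i) → ∑[ i < m ] f i ≤ ∑[ i < m ] g i
∑-mono-≤ {zero} f≤g = z≤n
∑-mono-≤ {suc m} f≤g = +-mono-≤ (f≤g zero) (∑-mono-≤ (λ i → f≤g (suc i)))

χ-∧ : ∀ a b → χ (a ∧ b) ≡ χ a * χ b
χ-∧ true b = sym (+-identityʳ (χ b))
χ-∧ false b = refl

χ-∧-split : ∀ a b → χ (a ∧ b) + χ (a ∧ not b) ≡ χ a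
χ-∧-split true true = refl
χ-∧-split true false = refl
χ-∧-split false b = refl

[m%d+n]%d≡[m+n]%d : ∀ m n d .{{_ : NonZero d}} → (m % d + n) % d ≡ (m + n) % d
[m%d+n]%d≡[m+n]%d m n d = begin
  (m % d + n) % d       ≡⟨ %-distribˡ-+ (m % d) n d ⟩
  (m % d % d + n % d) % d ≡⟨ cong (λ t → (t + n % d) % d) (m%n%n≡m%n m d) ⟩
  (m % d + n % d) % d   ≡⟨ %-distribˡ-+ m n d ⟨
  (m + n) % d           ∎
  where open ≡-Reasoning

module _ {n : ℕ} where

  toℕ-+ₚ : (x y : Fin (suc n)) → toℕ (x +ₚ y) ≡ (toℕ x + toℕ y) % suc n
  toℕ-+ₚ x y = toℕ-fromℕ< _

  +ₚ-comm : (x y : Fin (suc n)) → x +ₚ y ≡ y +ₚ x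
  +ₚ-comm x y = cong (_mod suc n) (+-comm (toℕ x) (toℕ y))

  -ₚ_ : Fin (suc n) → Fin (suc n)
  -ₚ y = (suc n ∸ toℕ y) mod suc n

  +ₚ-cancel : (x y z : Fin (suc n)) → (toℕ y + toℕ z) % suc n ≡ 0 → (x +ₚ y) +ₚ z ≡ x
  +ₚ-cancel x y z y+z≡0 = toℕ-injective (begin
    toℕ ((x +ₚ y) +ₚ z)                 ≡⟨ toℕ-+ₚ (x +ₚ y) z ⟩
    (toℕ (x +ₚ y) + toℕ z) % suc n       ≡⟨ cong (λ t → (t + toℕ z) % suc n) (toℕ-+ₚ x y) ⟩
    ((toℕ x + toℕ y) % suc n + toℕ z) % suc n ≡⟨ [m%d+n]%d≡[m+n]%d (toℕ x + toℕ y) (toℕ z) (suc n) ⟩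
    (toℕ x + toℕ y + toℕ z) % suc n      ≡⟨ cong (_% suc n) (+-assoc (toℕ x) (toℕ y) (toℕ z)) ⟩
    (toℕ x + (toℕ y + toℕ z)) % suc n    ≡⟨ %-distribˡ-+ (toℕ x) (toℕ y + toℕ z) (suc n) ⟩
    (toℕ x % suc n + (toℕ y + toℕ z) % suc n) % suc n ≡⟨ cong (λ t → (toℕ x % suc n + t) % suc n) y+z≡0 ⟩
    (toℕ x % suc n + 0) % suc n          ≡⟨ cong (_% suc n) (+-identityʳ (toℕ x % suc n)) ⟩
    toℕ x % suc n % suc n                ≡⟨ m%n%n≡m%n (toℕ x) (suc n) ⟩
    toℕ x % suc n                        ≡⟨ m<n⇒m%n≡m (toℕ<n x) ⟩
    toℕ x                                ∎)
    where open ≡-Reasoning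

  [y+-y]%p≡0 : (y : Fin (suc n)) → (toℕ y + toℕ (-ₚ y)) % suc n ≡ 0
  [y+-y]%p≡0 y = begin
    (toℕ y + toℕ (-ₚ y)) % suc n ≡⟨ cong (λ t → (toℕ y + t) % suc n) (toℕ-fromℕ< _) ⟩
    (toℕ y + (suc n ∸ toℕ y) % suc n) % suc n ≡⟨ cong (_% suc n) (+-comm (toℕ y) _) ⟩
    ((suc n ∸ toℕ y) % suc n + toℕ y) % suc n ≡⟨ [m%d+n]%d≡[m+n]%d (suc n ∸ toℕ y) (toℕ y) (suc n) ⟩
    (suc n ∸ toℕ y + toℕ y) % suc n ≡⟨ cong (_% suc n) (m∸n+n≡m (<⇒≤ (toℕ<n y))) ⟩
    suc n % suc n ≡⟨ n%n≡0 (suc n) ⟩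
    0 ∎
    where open ≡-Reasoning

  translation : Fin (suc n) → Permutation′ (suc n)
  translation y = permutation (_+ₚ y) (_+ₚ (-ₚ y))
    (λ x → +ₚ-cancel x (-ₚ y) y (trans (cong (_% suc n) (+-comm (toℕ (-ₚ y)) (toℕ y))) ([y+-y]%p≡0 y)))
    (λ x → +ₚ-cancel x y (-ₚ y) ([y+-y]%p≡0 y))

  ∑-translateʳ : (g : Fin (suc n) → ℕ) (y : Fin (suc n)) → ∑[ x < suc n ] g (x +ₚ y) ≡ ∑[ x < suc n ] g x
  ∑-translateʳ g y = sym (∑-permute g (translation y))

  ∑-translateˡ : (g : Fin (suc n) → ℕ) (x : Fin (suc n)) → ∑[ y < suc n ] g (x +ₚ y) ≡ ∑[ y < suc n ] g y
  ∑-translateˡ g x = trans (sum-cong-≗ (λ y → cong g (+ₚ-comm x y))) (∑-translateʳ g x)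

∈⇒lookup : ∀ {m} {S : Subset m} {x} → x ∈ S → lookup S x ≡ true
∈⇒lookup = []=⇒lookup

lookup⇒∈ : ∀ {m} {S : Subset m} {x} → lookup S x ≡ true → x ∈ S
lookup⇒∈ {S = S} {x} = lookup⇒[]= x S

lookup-─ : ∀ {m} (p q : Subset m) i → lookup (p ─ q) i ≡ lookup p i ∧ not (lookup q i)
lookup-─ (x ∷ p) (true ∷ q) zero = sym (∧-zeroʳ x)
lookup-─ (x ∷ p) (false ∷ q) zero = sym (∧-identityʳ x)
lookup-─ (x ∷ p) (_ ∷ q) (suc i) = lookup-─ p q i

∣p∪q∣≡∣p∣+∣q─p∣ : ∀ {m} (p q : Subset m) → ∣ p ∪ q ∣ ≡ ∣ p ∣ + ∣ q ─ p ∣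
∣p∪q∣≡∣p∣+∣q─p∣ [] [] = refl
∣p∪q∣≡∣p∣+∣q─p∣ (true ∷ p) (_ ∷ q) = cong suc (∣p∪q∣≡∣p∣+∣q─p∣ p q)
∣p∪q∣≡∣p∣+∣q─p∣ (false ∷ p) (true ∷ q) = trans (cong suc (∣p∪q∣≡∣p∣+∣q─p∣ p q)) (sym (+-suc ∣ p ∣ _))
∣p∪q∣≡∣p∣+∣q─p∣ (false ∷ p) (false ∷ q) = ∣p∪q∣≡∣p∣+∣q─p∣ p q

∣p∪q∣≤∣p∣+∣q∣ : ∀ {m} (p q : Subset m) → ∣ p ∪ q ∣ ≤ ∣ p ∣ + ∣ q ∣
∣p∪q∣≤∣p∣+∣q∣ p q = begin
  ∣ p ∪ q ∣       ≡⟨ ∣p∪q∣≡∣p∣+∣q─p∣ p q ⟩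
  ∣ p ∣ + ∣ q ─ p ∣ ≤⟨ +-monoʳ-≤ ∣ p ∣ (p⊆q⇒∣p∣≤∣q∣ (p─q⊆p q p)) ⟩
  ∣ p ∣ + ∣ q ∣     ∎
  where open ≤-Reasoning

∣[p∪q]─r∣≡∣p─r∣+∣q─[r∪p]∣ : ∀ {m} (p q r : Subset m) →
                            ∣ (p ∪ q) ─ r ∣ ≡ ∣ p ─ r ∣ + ∣ q ─ (r ∪ p) ∣
∣[p∪q]─r∣≡∣p─r∣+∣q─[r∪p]∣ p q r = +-cancelˡ-≡ ∣ r ∣ _ _ (begin
  ∣ r ∣ + ∣ (p ∪ q) ─ r ∣              ≡⟨ ∣p∪q∣≡∣p∣+∣q─p∣ r (p ∪ q) ⟨
  ∣ r ∪ (p ∪ q) ∣                     ≡⟨ cong ∣_∣ (∪-assoc r p q) ⟨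
  ∣ (r ∪ p) ∪ q ∣                     ≡⟨ ∣p∪q∣≡∣p∣+∣q─p∣ (r ∪ p) q ⟩
  ∣ r ∪ p ∣ + ∣ q ─ (r ∪ p) ∣           ≡⟨ cong (_+ ∣ q ─ (r ∪ p) ∣) (∣p∪q∣≡∣p∣+∣q─p∣ r p) ⟩
  ∣ r ∣ + ∣ p ─ r ∣ + ∣ q ─ (r ∪ p) ∣   ≡⟨ +-assoc ∣ r ∣ _ _ ⟩
  ∣ r ∣ + (∣ p ─ r ∣ + ∣ q ─ (r ∪ p) ∣) ∎)
  where open ≡-Reasoning

p⊆q⇒p∪q≡q : ∀ {m} {p q : Subset m} → p ⊆ q → p ∪ q ≡ q
p⊆q⇒p∪q≡q {p = p} {q} p⊆q = ⊆-antisym (λ x∈p∪q → [ p⊆q , id ]′ (x∈p∪q⁻ p q x∈p∪q)) (q⊆p∪q p q)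

p⊆q⇒∣p─r∣+∣q─[r∪p]∣≡∣q─r∣ : ∀ {m} {p q : Subset m} (r : Subset m) → p ⊆ q →
                             ∣ p ─ r ∣ + ∣ q ─ (r ∪ p) ∣ ≡ ∣ q ─ r ∣
p⊆q⇒∣p─r∣+∣q─[r∪p]∣≡∣q─r∣ {p = p} {q} r p⊆q =
  trans (sym (∣[p∪q]─r∣≡∣p─r∣+∣q─[r∪p]∣ p q r)) (cong (λ s → ∣ s ─ r ∣) (p⊆q⇒p∪q≡q p⊆q))

p⊆q⇒∣p─r∣≤∣q─r∣ : ∀ {m} {p q : Subset m} (r : Subset m) → p ⊆ q → ∣ p ─ r ∣ ≤ ∣ q ─ r ∣
p⊆q⇒∣p─r∣≤∣q─r∣ r p⊆q = ≤-trans (m≤m+n _ _) (≤-reflexive (p⊆q⇒∣p─r∣+∣q─[r∪p]∣≡∣q─r∣ r p⊆q))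

p⊆q⇒p∪⁅x⁆⊆q : ∀ {m} {p q : Subset m} {x} → p ⊆ q → x ∈ q → p ∪ ⁅ x ⁆ ⊆ q
p⊆q⇒p∪⁅x⁆⊆q {p = p} {q} {x} p⊆q x∈q y∈ =
  [ p⊆q , (λ y∈⁅x⁆ → subst (_∈ q) (sym (x∈⁅y⁆⇒x≡y x y∈⁅x⁆)) x∈q) ]′ (x∈p∪q⁻ p ⁅ x ⁆ y∈)

∣p∣≤j⇒∣p∪⁅x⁆∣≤1+j : ∀ {m} (p : Subset m) {j} x → ∣ p ∣ ≤ j → ∣ p ∪ ⁅ x ⁆ ∣ ≤ suc j
∣p∣≤j⇒∣p∪⁅x⁆∣≤1+j p {j} x ∣p∣≤j = begin
  ∣ p ∪ ⁅ x ⁆ ∣      ≤⟨ ∣p∪q∣≤∣p∣+∣q∣ p ⁅ x ⁆ ⟩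
  ∣ p ∣ + ∣ ⁅ x ⁆ ∣  ≡⟨ cong (∣ p ∣ +_) (∣⁅x⁆∣≡1 x) ⟩
  ∣ p ∣ + 1         ≤⟨ +-monoˡ-≤ 1 ∣p∣≤j ⟩
  j + 1             ≡⟨ +-comm j 1 ⟩
  suc j             ∎
  where open ≤-Reasoning

⊆-extend : ∀ {m} (A B : Subset m) {c} → A ⊆ B → ∣ A ∣ ≤ c → c ≤ ∣ B ∣ →
           ∃ λ C → A ⊆ C × C ⊆ B × ∣ C ∣ ≡ c
⊆-extend [] [] A⊆B _ c≤0 = [] , ⊆-refl , ⊆-refl , sym (n≤0⇒n≡0 c≤0)
⊆-extend (true ∷ A) (false ∷ B) A⊆B _ _ with A⊆B here
... | ()
⊆-extend (true ∷ A) (true ∷ B) A⊆B (s≤s a≤c) (s≤s c≤b) with ⊆-extend A B (drop-∷-⊆ A⊆B) a≤c c≤b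
... | C , A⊆C , C⊆B , ∣C∣≡c = true ∷ C , in⊆in A⊆C , in⊆in C⊆B , cong suc ∣C∣≡c
⊆-extend (false ∷ A) (false ∷ B) A⊆B a≤c c≤b with ⊆-extend A B (drop-∷-⊆ A⊆B) a≤c c≤b
... | C , A⊆C , C⊆B , ∣C∣≡c = false ∷ C , out⊆ A⊆C , out⊆ C⊆B , ∣C∣≡c
⊆-extend (false ∷ A) (true ∷ B) {c} A⊆B a≤c c≤1+b with c ≤? ∣ B ∣
... | yes c≤b with ⊆-extend A B (drop-∷-⊆ A⊆B) a≤c c≤b
...   | C , A⊆C , C⊆B , ∣C∣≡c = false ∷ C , out⊆ A⊆C , out⊆ C⊆B , ∣C∣≡c
⊆-extend (false ∷ A) (true ∷ B) A⊆B a≤c c≤1+b | no c≰b =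
  true ∷ B , out⊆ (drop-∷-⊆ A⊆B) , ⊆-refl , ≤-antisym (≰⇒> c≰b) c≤1+b

subset-of-size : ∀ {m} (B : Subset m) {c} → c ≤ ∣ B ∣ → ∃ λ C → C ⊆ B × ∣ C ∣ ≡ c
subset-of-size {m} B c≤b with ⊆-extend ∅ B ⊥⊆ (≤-trans (≤-reflexive (∣⊥∣≡0 m)) z≤n) c≤b
... | C , _ , C⊆B , ∣C∣≡c = C , C⊆B , ∣C∣≡c

module _ {n : ℕ} {A B : Subset (suc n)} where

  sumset? : ∀ z → Dec (∃ λ x → ∃ λ y → x ∈ A × y ∈ B × x +ₚ y ≡ z)
  sumset? z = any? λ x → any? λ y → (x ∈? A) ×-dec ((y ∈? B) ×-dec ((x +ₚ y) ≟ z))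

  x+y∈sumset : ∀ {x y} → x ∈ A → y ∈ B → x +ₚ y ∈ sumset A B
  x+y∈sumset {x} {y} x∈A y∈B = lookup⇒∈ (trans (lookup∘tabulate (⌊_⌋ ∘ sumset?) (x +ₚ y))
    (Equivalence.to T-≡ (fromWitness (x , y , x∈A , y∈B , refl))))

  ∈sumset⇒ : ∀ {z} → z ∈ sumset A B → ∃ λ x → ∃ λ y → x ∈ A × y ∈ B × x +ₚ y ≡ z
  ∈sumset⇒ {z} z∈A+B = toWitness (Equivalence.from T-≡
    (trans (sym (lookup∘tabulate (⌊_⌋ ∘ sumset?) z)) (∈⇒lookup z∈A+B)))

sumset-mono : ∀ {n} {A A′ B B′ : Subset (suc n)} → A ⊆ A′ → B ⊆ B′ → sumset A B ⊆ sumset A′ B′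
sumset-mono A⊆A′ B⊆B′ z∈A+B with ∈sumset⇒ z∈A+B
... | x , y , x∈A , y∈B , refl = x+y∈sumset (A⊆A′ x∈A) (B⊆B′ y∈B)

more-than-half : ∀ {a h m} → h + m ≡ a → 2 * m < a → a < 2 * h
more-than-half {a} {h} {m} h+m≡a 2m<a = +-cancelʳ-< a a (2 * h) (begin-strict
  a + a               ≡⟨ cong (a +_) (+-identityʳ a) ⟨
  2 * a               ≡⟨ cong (2 *_) h+m≡a ⟨
  2 * (h + m)         ≡⟨ *-distribˡ-+ 2 h m ⟩
  2 * h + 2 * m       <⟨ +-monoʳ-< (2 * h) 2m<a ⟩
  2 * h + a           ∎)
  where open ≤-Reasoning

16x≤2r⇒2x≤r : ∀ {x r} → 16 * x ≤ 2 * r → 2 * x ≤ r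
16x≤2r⇒2x≤r {x} {r} 16x≤2r = ≤-trans (*-monoˡ-≤ x (m≤m+n 2 6))
  (*-cancelˡ-≤ 2 (≤-trans (≤-reflexive (sym (*-assoc 2 8 x))) 16x≤2r))

budget-filled : ∀ {w r y D} → y ≤ 2 * (w + r) → 16 * w + D ≤ 2 * y → D ≤ 16 * r
budget-filled {w} {r} {y} {D} y≤2[w+r] room = +-cancelˡ-≤ (16 * w) D (16 * r) (begin
  16 * w + D          ≤⟨ room ⟩
  2 * y               ≤⟨ *-monoʳ-≤ 2 y≤2[w+r] ⟩
  2 * (2 * (w + r))   ≡⟨ *-assoc 2 2 (w + r) ⟨
  4 * (w + r)         ≡⟨ *-distribˡ-+ 4 w r ⟩
  4 * w + 4 * r       ≤⟨ +-mono-≤ (*-monoˡ-≤ w (m≤m+n 4 12)) (*-monoˡ-≤ r (m≤m+n 4 12)) ⟩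
  16 * w + 16 * r     ∎)
  where open ≤-Reasoning

module _ {n : ℕ} where

  hits misses : (A W : Subset (suc n)) → Fin (suc n) → ℕ
  hits A W y = ∑[ x < suc n ] χ (lookup A x ∧ lookup W (x +ₚ y))
  misses A W y = ∑[ x < suc n ] χ (lookup A x ∧ not (lookup W (x +ₚ y)))

  hits+misses≡∣A∣ : ∀ A W y → hits A W y + misses A W y ≡ ∣ A ∣
  hits+misses≡∣A∣ A W y = begin
    hits A W y + misses A W y
      ≡⟨ ∑-distrib-+ (λ x → χ (lookup A x ∧ lookup W (x +ₚ y)))
                     (λ x → χ (lookup A x ∧ not (lookup W (x +ₚ y)))) ⟨
    ∑[ x < suc n ] (χ (lookup A x ∧ lookup W (x +ₚ y)) + χ (lookup A x ∧ not (lookup W (x +ₚ y))))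
      ≡⟨ sum-cong-≗ (λ x → χ-∧-split (lookup A x) (lookup W (x +ₚ y))) ⟩
    ∑[ x < suc n ] χ (lookup A x)
      ≡⟨ ∣p∣≡∑χ A ⟨
    ∣ A ∣ ∎
    where open ≡-Reasoning

  ∑-hits≡∣A∣*∣W∣ : ∀ A W → ∑[ y < suc n ] hits A W y ≡ ∣ A ∣ * ∣ W ∣
  ∑-hits≡∣A∣*∣W∣ A W = begin
    ∑[ y < suc n ] ∑[ x < suc n ] χ (lookup A x ∧ lookup W (x +ₚ y))
      ≡⟨ sum-cong-≗ (λ y → sum-cong-≗ (λ x → χ-∧ (lookup A x) (lookup W (x +ₚ y)))) ⟩
    ∑[ y < suc n ] ∑[ x < suc n ] (χ (lookup A x) * χ (lookup W (x +ₚ y)))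
      ≡⟨ ∑-comm (λ y x → χ (lookup A x) * χ (lookup W (x +ₚ y))) ⟩
    ∑[ x < suc n ] ∑[ y < suc n ] (χ (lookup A x) * χ (lookup W (x +ₚ y)))
      ≡⟨ sum-cong-≗ (λ x → *-distribˡ-sum (χ (lookup A x)) (λ y → χ (lookup W (x +ₚ y)))) ⟨
    ∑[ x < suc n ] (χ (lookup A x) * ∑[ y < suc n ] χ (lookup W (x +ₚ y)))
      ≡⟨ sum-cong-≗ (λ x → cong (χ (lookup A x) *_)
                        (trans (∑-translateˡ (χ ∘ lookup W) x) (sym (∣p∣≡∑χ W)))) ⟩
    ∑[ x < suc n ] (χ (lookup A x) * ∣ W ∣)
      ≡⟨ *-distribʳ-sum ∣ W ∣ (χ ∘ lookup A) ⟨
    (∑[ x < suc n ] χ (lookup A x)) * ∣ W ∣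
      ≡⟨ cong (_* ∣ W ∣) (∣p∣≡∑χ A) ⟨
    ∣ A ∣ * ∣ W ∣ ∎
    where open ≡-Reasoning

  -- Otherwise every y ∈ Y has more than |A|/2 hits, so |Y||A|/2 < ∑ hits = |A||W|.
  ∃-misses-half : ∀ A Y W → 2 * ∣ W ∣ < ∣ Y ∣ → ∃ λ y → y ∈ Y × ∣ A ∣ ≤ 2 * misses A W y
  ∃-misses-half A Y W 2∣W∣<∣Y∣ with any? (λ y → (y ∈? Y) ×-dec (∣ A ∣ ≤? 2 * misses A W y))
  ... | yes found = found
  ... | no none = contradiction (<-≤-trans 2∣W∣<∣Y∣ ∣Y∣≤0) n≮0
    where
    many-hits : ∀ y → χ (lookup Y y) * suc ∣ A ∣ ≤ 2 * hits A W y
    many-hits y with lookup Y y in y∈?Y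
    ... | false = z≤n
    ... | true = ≤-trans (≤-reflexive (+-identityʳ (suc ∣ A ∣)))
        (more-than-half {h = hits A W y} (hits+misses≡∣A∣ A W y)
          (≰⇒> λ ∣A∣≤2m → none (y , lookup⇒∈ y∈?Y , ∣A∣≤2m)))

    ∣Y∣≤0 : ∣ Y ∣ ≤ 0
    ∣Y∣≤0 = +-cancelʳ-≤ (∣ A ∣ * ∣ Y ∣) ∣ Y ∣ 0 (begin
      ∣ Y ∣ + ∣ A ∣ * ∣ Y ∣                          ≡⟨ cong (∣ Y ∣ +_) (*-comm ∣ A ∣ ∣ Y ∣) ⟩
      ∣ Y ∣ + ∣ Y ∣ * ∣ A ∣                          ≡⟨ *-suc ∣ Y ∣ ∣ A ∣ ⟨
      ∣ Y ∣ * suc ∣ A ∣                             ≡⟨ cong (_* suc ∣ A ∣) (∣p∣≡∑χ Y) ⟩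
      (∑[ y < suc n ] χ (lookup Y y)) * suc ∣ A ∣   ≡⟨ *-distribʳ-sum (suc ∣ A ∣) (χ ∘ lookup Y) ⟩
      ∑[ y < suc n ] (χ (lookup Y y) * suc ∣ A ∣)   ≤⟨ ∑-mono-≤ many-hits ⟩
      ∑[ y < suc n ] (2 * hits A W y)              ≡⟨ *-distribˡ-sum 2 (hits A W) ⟨
      2 * (∑[ y < suc n ] hits A W y)              ≡⟨ cong (2 *_) (∑-hits≡∣A∣*∣W∣ A W) ⟩
      2 * (∣ A ∣ * ∣ W ∣)                           ≡⟨ *-assoc 2 ∣ A ∣ ∣ W ∣ ⟨
      2 * ∣ A ∣ * ∣ W ∣                             ≡⟨ cong (_* ∣ W ∣) (*-comm 2 ∣ A ∣) ⟩
      ∣ A ∣ * 2 * ∣ W ∣                             ≡⟨ *-assoc (∣ A ∣) 2 (∣ W ∣) ⟩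
      ∣ A ∣ * (2 * ∣ W ∣)                           ≤⟨ *-monoʳ-≤ ∣ A ∣ (<⇒≤ 2∣W∣<∣Y∣) ⟩
      ∣ A ∣ * ∣ Y ∣                                 ∎)
      where open ≤-Reasoning

  misses≤∣T─W∣ : ∀ {A T} W y → (∀ {x} → x ∈ A → x +ₚ y ∈ T) → misses A W y ≤ ∣ T ─ W ∣
  misses≤∣T─W∣ {A} {T} W y A+y⊆T = begin
    misses A W y                                 ≤⟨ ∑-mono-≤ outside-W ⟩
    ∑[ x < suc n ] χ (lookup (T ─ W) (x +ₚ y))   ≡⟨ ∑-translateʳ (χ ∘ lookup (T ─ W)) y ⟩
    ∑[ z < suc n ] χ (lookup (T ─ W) z)          ≡⟨ ∣p∣≡∑χ (T ─ W) ⟨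
    ∣ T ─ W ∣                                     ∎
    where
    open ≤-Reasoning
    outside-W : ∀ x → χ (lookup A x ∧ not (lookup W (x +ₚ y))) ≤ χ (lookup (T ─ W) (x +ₚ y))
    outside-W x rewrite lookup-─ T W (x +ₚ y) with lookup A x in x∈?A
    ... | false = z≤n
    ... | true rewrite ∈⇒lookup (A+y⊆T (lookup⇒∈ x∈?A)) = ≤-refl

  add-translate : ∀ {A Y′ j} W y → j * ∣ A ∣ ≤ 2 * ∣ sumset A Y′ ─ W ∣ →
                  ∣ A ∣ ≤ 2 * misses A (W ∪ sumset A Y′) y →
                  suc j * ∣ A ∣ ≤ 2 * ∣ sumset A (Y′ ∪ ⁅ y ⁆) ─ W ∣
  add-translate {A} {Y′} {j} W y j∣A∣≤2∣S─W∣ ∣A∣≤2misses = begin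
    ∣ A ∣ + j * ∣ A ∣                ≤⟨ +-mono-≤ ∣A∣≤2misses j∣A∣≤2∣S─W∣ ⟩
    2 * misses A (W ∪ S) y + 2 * ∣ S ─ W ∣ ≡⟨ +-comm (2 * misses A (W ∪ S) y) _ ⟩
    2 * ∣ S ─ W ∣ + 2 * misses A (W ∪ S) y ≡⟨ *-distribˡ-+ 2 ∣ S ─ W ∣ _ ⟨
    2 * (∣ S ─ W ∣ + misses A (W ∪ S) y)   ≤⟨ *-monoʳ-≤ 2 (+-monoʳ-≤ ∣ S ─ W ∣ (misses≤∣T─W∣ (W ∪ S) y A+y⊆T)) ⟩
    2 * (∣ S ─ W ∣ + ∣ T ─ (W ∪ S) ∣)        ≡⟨ cong (2 *_) (p⊆q⇒∣p─r∣+∣q─[r∪p]∣≡∣q─r∣ W S⊆T) ⟩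
    2 * ∣ T ─ W ∣                          ∎
    where
    open ≤-Reasoning
    S T : Subset (suc n)
    S = sumset A Y′
    T = sumset A (Y′ ∪ ⁅ y ⁆)
    S⊆T : S ⊆ T
    S⊆T = sumset-mono ⊆-refl (p⊆p∪q ⁅ y ⁆)
    A+y⊆T : ∀ {x} → x ∈ A → x +ₚ y ∈ T
    A+y⊆T x∈A = x+y∈sumset x∈A (q⊆p∪q Y′ ⁅ y ⁆ (x∈⁅x⁆ y))

  Progress : (A Y W : Subset (suc n)) → ℕ → Subset (suc n) → Set
  Progress A Y W j Y′ = j * ∣ A ∣ ≤ 2 * ∣ sumset A Y′ ─ W ∣ ⊎ ∣ Y ∣ ≤ 2 * ∣ W ∪ sumset A Y′ ∣

  Progress-mono : ∀ {A Y W j Y₁ Y₂} → Y₁ ⊆ Y₂ → Progress A Y W j Y₁ → Progress A Y W j Y₂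
  Progress-mono {A} {Y} {W} {j} {Y₁} {Y₂} Y₁⊆Y₂ = ⊎-map
    (λ gain → ≤-trans gain (*-monoʳ-≤ 2 (p⊆q⇒∣p─r∣≤∣q─r∣ W S₁⊆S₂)))
    (λ full → ≤-trans full (*-monoʳ-≤ 2 (p⊆q⇒∣p∣≤∣q∣ (λ z∈ → x∈p∪q⁺ (map₂ S₁⊆S₂ (x∈p∪q⁻ W _ z∈))))))
    where
    S₁⊆S₂ : sumset A Y₁ ⊆ sumset A Y₂
    S₁⊆S₂ = sumset-mono ⊆-refl Y₁⊆Y₂

  Greedy : (A Y W : Subset (suc n)) → ℕ → Set
  Greedy A Y W j = ∃ λ Y′ → Y′ ⊆ Y × ∣ Y′ ∣ ≤ j × Progress A Y W j Y′

  greedy : ∀ A Y W j → Greedy A Y W j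
  greedy A Y W zero = ∅ , ⊥⊆ , ≤-reflexive (∣⊥∣≡0 (suc n)) , inj₁ z≤n
  greedy A Y W (suc j) = step (greedy A Y W j)
    where
    step : Greedy A Y W j → Greedy A Y W (suc j)
    step (Y′ , Y′⊆Y , ∣Y′∣≤j , progress) = grow (∣ Y ∣ ≤? 2 * ∣ W ∪ sumset A Y′ ∣)
      where
      grow : Dec (∣ Y ∣ ≤ 2 * ∣ W ∪ sumset A Y′ ∣) → Greedy A Y W (suc j)
      grow (yes full) = Y′ , Y′⊆Y , m≤n⇒m≤1+n ∣Y′∣≤j , inj₂ full
      grow (no ¬full) =
        let y , y∈Y , ∣A∣≤2misses = ∃-misses-half A Y (W ∪ sumset A Y′) (≰⇒> ¬full)
        in  Y′ ∪ ⁅ y ⁆ , p⊆q⇒p∪⁅x⁆⊆q Y′⊆Y y∈Y , ∣p∣≤j⇒∣p∪⁅x⁆∣≤1+j Y′ y ∣Y′∣≤j ,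
            inj₁ (add-translate {j = j} W y ([ id , (λ full → contradiction full ¬full) ]′ progress)
                                ∣A∣≤2misses)

  greedy-exact : ∀ A Y W {j} → j ≤ ∣ Y ∣ → ∃ λ Y′ → (Y′ ⊆ Y × ∣ Y′ ∣ ≡ j) × Progress A Y W j Y′
  greedy-exact A Y W {j} j≤∣Y∣ =
    let Yᵍ , Yᵍ⊆Y , ∣Yᵍ∣≤j , progress = greedy A Y W j
        Y′ , Yᵍ⊆Y′ , Y′⊆Y , ∣Y′∣≡j = ⊆-extend Yᵍ Y Yᵍ⊆Y ∣Yᵍ∣≤j j≤∣Y∣
    in  Y′ , (Y′⊆Y , ∣Y′∣≡j) , Progress-mono {A = A} {Y = Y} {W = W} {j = j} Yᵍ⊆Y′ progress

module _ {n : ℕ} where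

  record Admissible (X Y : Subset (suc n)) (c₁ c₂ : ℕ) : Set where
    field
      c₁≤∣X∣ : c₁ ≤ ∣ X ∣
      c₂≤∣Y∣ : c₂ ≤ ∣ Y ∣
      16∣X∣≤c₁c₂ : 16 * ∣ X ∣ ≤ c₁ * c₂

  Outcome : (X S W : Subset (suc n)) (D : ℕ) → Set
  Outcome X S W D = D ≤ 16 * ∣ S ─ W ∣ ⊎ 2 * ∣ X ∣ ≤ ∣ S ─ W ∣ × 16 * ∣ S ─ W ∣ ≤ D

  outcome : ∀ {X X′ Y Y′ W c₁ c₂ D} → Admissible X Y c₁ c₂ → ∣ X′ ∣ ≡ c₁ → 16 * ∣ W ∣ + D ≤ 2 * ∣ Y ∣ →
            Progress X′ Y W c₂ Y′ → Dec (D ≤ 16 * ∣ sumset X′ Y′ ─ W ∣) → Outcome X (sumset X′ Y′) W D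
  outcome adm ∣X′∣≡c₁ room progress (yes filled) = inj₁ filled
  outcome {X} {X′} {Y} {Y′} {W} {c₁} {c₂} {D} adm ∣X′∣≡c₁ room progress (no ¬filled) =
    inj₂ (16x≤2r⇒2x≤r {x = ∣ X ∣} {r = ∣ S ─ W ∣} 16∣X∣≤2r , <⇒≤ (≰⇒> ¬filled))
    where
    S : Subset (suc n)
    S = sumset X′ Y′
    c₂∣X′∣≤2r : c₂ * ∣ X′ ∣ ≤ 2 * ∣ S ─ W ∣
    c₂∣X′∣≤2r = [ id , (λ full → contradiction (filled full) ¬filled) ]′ progress
      where
      filled : ∣ Y ∣ ≤ 2 * ∣ W ∪ S ∣ → D ≤ 16 * ∣ S ─ W ∣
      filled full = budget-filled {w = ∣ W ∣} (≤-trans full (≤-reflexive (cong (2 *_) (∣p∪q∣≡∣p∣+∣q─p∣ W S)))) room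
    16∣X∣≤2r : 16 * ∣ X ∣ ≤ 2 * ∣ S ─ W ∣
    16∣X∣≤2r = begin
      16 * ∣ X ∣   ≤⟨ Admissible.16∣X∣≤c₁c₂ adm ⟩
      c₁ * c₂     ≡⟨ *-comm c₁ c₂ ⟩
      c₂ * c₁     ≡⟨ cong (c₂ *_) ∣X′∣≡c₁ ⟨
      c₂ * ∣ X′ ∣  ≤⟨ c₂∣X′∣≤2r ⟩
      2 * ∣ S ─ W ∣ ∎
      where open ≤-Reasoning

  Cover : ∀ {k} (X Y : Fin k → Subset (suc n)) (c₁ c₂ : Fin k → ℕ) (W : Subset (suc n)) (D : ℕ) → Set
  Cover {k} X Y c₁ c₂ W D = Σ (Fin k → Subset (suc n)) λ X′ → Σ (Fin k → Subset (suc n)) λ Y′ →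
      (∀ i → X′ i ⊆ X i × ∣ X′ i ∣ ≡ c₁ i)
    × (∀ i → Y′ i ⊆ Y i × ∣ Y′ i ∣ ≡ c₂ i)
    × D ≤ 16 * ∣ ⋃ᵢ (λ i → sumset (X′ i) (Y′ i)) ─ W ∣

  cons-cover : ∀ {k} {X Y : Fin (suc k) → Subset (suc n)} {c₁ c₂ W D W′ D′ X₀ Y₀} →
               X₀ ⊆ X zero × ∣ X₀ ∣ ≡ c₁ zero → Y₀ ⊆ Y zero × ∣ Y₀ ∣ ≡ c₂ zero →
               (∀ U → D′ ≤ 16 * ∣ U ─ W′ ∣ → D ≤ 16 * ∣ (sumset X₀ Y₀ ∪ U) ─ W ∣) →
               Cover (X ∘ suc) (Y ∘ suc) (c₁ ∘ suc) (c₂ ∘ suc) W′ D′ → Cover X Y c₁ c₂ W D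
  cons-cover {X₀ = X₀} {Y₀} hX₀ hY₀ bound (X′ , Y′ , hX′ , hY′ , D′≤) =
    X₀ Vector.∷ X′ , Y₀ Vector.∷ Y′ , ∀-cons hX₀ hX′ , ∀-cons hY₀ hY′ ,
    bound (⋃ᵢ (λ i → sumset (X′ i) (Y′ i))) D′≤

  cover-step : ∀ {k} {X Y : Fin (suc k) → Subset (suc n)} {c₁ c₂ W D X₀ Y₀} →
    X₀ ⊆ X zero × ∣ X₀ ∣ ≡ c₁ zero → Y₀ ⊆ Y zero × ∣ Y₀ ∣ ≡ c₂ zero →
    D ≤ 16 * (2 * Σᵢ (λ i → ∣ X i ∣)) → (∀ i → 16 * ∣ W ∣ + D ≤ 2 * ∣ Y i ∣) →
    Outcome (X zero) (sumset X₀ Y₀) W D →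
    (∀ W′ D′ → D′ ≤ 16 * (2 * Σᵢ (λ i → ∣ X (suc i) ∣)) → (∀ i → 16 * ∣ W′ ∣ + D′ ≤ 2 * ∣ Y (suc i) ∣) →
       Cover (X ∘ suc) (Y ∘ suc) (c₁ ∘ suc) (c₂ ∘ suc) W′ D′) →
    Cover X Y c₁ c₂ W D
  cover-step {W = W} {X₀ = X₀} {Y₀} hX₀ hY₀ D≤M room (inj₁ D≤16r) cover-rest =
    cons-cover hX₀ hY₀
      (λ U _ → ≤-trans D≤16r (*-monoʳ-≤ 16 (p⊆q⇒∣p─r∣≤∣q─r∣ W (p⊆p∪q {p = sumset X₀ Y₀} U))))
      (cover-rest W 0 z≤n (λ i → ≤-trans (+-monoʳ-≤ (16 * ∣ W ∣) z≤n) (room (suc i))))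
  cover-step {X = X} {Y} {W = W} {D} {X₀} {Y₀} hX₀ hY₀ D≤M room (inj₂ (2∣X₀∣≤r , 16r≤D)) cover-rest =
    cons-cover hX₀ hY₀ bound (cover-rest (W ∪ S₀) (D ∸ 16 * r) rest room′)
    where
    S₀ : Subset (suc n)
    S₀ = sumset X₀ Y₀
    r Σ′ : ℕ
    r = ∣ S₀ ─ W ∣
    Σ′ = Σᵢ (λ i → ∣ X (suc i) ∣)
    rest : D ∸ 16 * r ≤ 16 * (2 * Σ′)
    rest = m≤n+o⇒m∸n≤o D (16 * r) (begin
      D                                  ≤⟨ D≤M ⟩
      16 * (2 * (∣ X zero ∣ + Σ′))         ≡⟨ cong (16 *_) (*-distribˡ-+ 2 ∣ X zero ∣ Σ′) ⟩
      16 * (2 * ∣ X zero ∣ + 2 * Σ′)       ≡⟨ *-distribˡ-+ 16 (2 * ∣ X zero ∣) (2 * Σ′) ⟩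
      16 * (2 * ∣ X zero ∣) + 16 * (2 * Σ′) ≤⟨ +-monoˡ-≤ (16 * (2 * Σ′)) (*-monoʳ-≤ 16 2∣X₀∣≤r) ⟩
      16 * r + 16 * (2 * Σ′)              ∎)
      where open ≤-Reasoning
    room′ : ∀ i → 16 * ∣ W ∪ S₀ ∣ + (D ∸ 16 * r) ≤ 2 * ∣ Y (suc i) ∣
    room′ i = ≤-trans (≤-reflexive (begin
      16 * ∣ W ∪ S₀ ∣ + (D ∸ 16 * r)        ≡⟨ cong (λ t → 16 * t + (D ∸ 16 * r)) (∣p∪q∣≡∣p∣+∣q─p∣ W S₀) ⟩
      16 * (∣ W ∣ + r) + (D ∸ 16 * r)       ≡⟨ cong (_+ (D ∸ 16 * r)) (*-distribˡ-+ 16 ∣ W ∣ r) ⟩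
      16 * ∣ W ∣ + 16 * r + (D ∸ 16 * r)    ≡⟨ +-assoc (16 * ∣ W ∣) (16 * r) _ ⟩
      16 * ∣ W ∣ + (16 * r + (D ∸ 16 * r))  ≡⟨ cong (16 * ∣ W ∣ +_) (m+[n∸m]≡n 16r≤D) ⟩
      16 * ∣ W ∣ + D                       ∎)) (room (suc i))
      where open ≡-Reasoning
    bound : ∀ U → D ∸ 16 * r ≤ 16 * ∣ U ─ (W ∪ S₀) ∣ → D ≤ 16 * ∣ (S₀ ∪ U) ─ W ∣
    bound U D∸16r≤ = begin
      D                                  ≡⟨ m+[n∸m]≡n 16r≤D ⟨
      16 * r + (D ∸ 16 * r)               ≤⟨ +-monoʳ-≤ (16 * r) D∸16r≤ ⟩
      16 * r + 16 * ∣ U ─ (W ∪ S₀) ∣       ≡⟨ *-distribˡ-+ 16 r _ ⟨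
      16 * (r + ∣ U ─ (W ∪ S₀) ∣)          ≡⟨ cong (16 *_) (∣[p∪q]─r∣≡∣p─r∣+∣q─[r∪p]∣ S₀ U W) ⟨
      16 * ∣ (S₀ ∪ U) ─ W ∣                ∎
      where open ≤-Reasoning

  -- W is the part of ℤ_p already covered and D is 16 times the number of points still wanted;
  -- the invariant 16|W| + D ≤ 2|Yᵢ| keeps the greedy step available for every remaining pair.
  cover : ∀ {k} (X Y : Fin k → Subset (suc n)) (c₁ c₂ : Fin k → ℕ) →
          (∀ i → Admissible (X i) (Y i) (c₁ i) (c₂ i)) → ∀ W D →
          D ≤ 16 * (2 * Σᵢ (λ i → ∣ X i ∣)) → (∀ i → 16 * ∣ W ∣ + D ≤ 2 * ∣ Y i ∣) →
          Cover X Y c₁ c₂ W D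
  cover {zero} X Y c₁ c₂ adm W D D≤0 room = (λ ()) , (λ ()) , (λ ()) , (λ ()) , ≤-trans D≤0 z≤n
  cover {suc k} X Y c₁ c₂ adm W D D≤M room =
    let X₀ , X₀⊆X , ∣X₀∣≡c₁ = subset-of-size (X zero) (Admissible.c₁≤∣X∣ (adm zero))
        Y₀ , hY₀ , progress = greedy-exact X₀ (Y zero) W (Admissible.c₂≤∣Y∣ (adm zero))
    in  cover-step (X₀⊆X , ∣X₀∣≡c₁) hY₀ D≤M room
          (outcome {X′ = X₀} {Y′ = Y₀} {W = W} (adm zero) ∣X₀∣≡c₁ (room zero) progress
                   (D ≤? 16 * ∣ sumset X₀ Y₀ ─ W ∣))
          (cover (X ∘ suc) (Y ∘ suc) (c₁ ∘ suc) (c₂ ∘ suc) (adm ∘ suc))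

minᵢ≤a : ∀ {k} a (f : Fin k → ℕ) → minᵢ a f ≤ a
minᵢ≤a {zero} a f = ≤-refl
minᵢ≤a {suc k} a f = ≤-trans (m⊓n≤n (f zero) _) (minᵢ≤a a (f ∘ suc))

minᵢ≤f : ∀ {k} a (f : Fin k → ℕ) i → minᵢ a f ≤ f i
minᵢ≤f a f zero = m⊓n≤m (f zero) _
minᵢ≤f a f (suc i) = ≤-trans (m⊓n≤n (f zero) _) (minᵢ≤f a (f ∘ suc) i)

corollary11 : (p : ℕ) → Prime p → (k : ℕ)
    → (X Y : Fin k → Subset p) → (Z : Subset p)
    → (c₁ c₂ : Fin k → ℕ)
    → (∀ i → 1 ≤ c₁ i × c₁ i ≤ ∣ X i ∣)
    → (∀ i → 1 ≤ c₂ i × c₂ i ≤ ∣ Y i ∣)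
    → (∀ i → 16 * ∣ X i ∣ ≤ c₁ i * c₂ i)
    → (∀ i → 16 * ∣ X i ∣ ≤ ∣ Y i ∣)
    → (∀ i → 16 * ∣ Z ∣ ≤ ∣ Y i ∣)
    → (∀ i → 2 * ∣ Y i ∣ < p)
    → Σ (Fin k → Subset p) λ X′ → Σ (Fin k → Subset p) λ Y′ →
        (∀ i → X′ i ⊆ X i × ∣ X′ i ∣ ≡ c₁ i)
      × (∀ i → Y′ i ⊆ Y i × ∣ Y′ i ∣ ≡ c₂ i)
      × minᵢ (16 * (2 * Σᵢ (λ i → ∣ X i ∣))) (λ i → ∣ Y i ∣)
          ≤ 16 * ∣ ⋃ᵢ (λ i → sumset (X′ i) (Y′ i)) ─ Z ∣
corollary11 zero p-prime = ⊥-elim (NonZero.nonZero (prime⇒nonZero p-prime))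
corollary11 (suc n) _ k X Y Z c₁ c₂ c₁-bounds c₂-bounds 16∣X∣≤c₁c₂ _ 16∣Z∣≤∣Y∣ _ =
  cover X Y c₁ c₂ adm Z D (minᵢ≤a M (λ i → ∣ Y i ∣)) room
  where
  M D : ℕ
  M = 16 * (2 * Σᵢ (λ i → ∣ X i ∣))
  D = minᵢ M (λ i → ∣ Y i ∣)
  adm : ∀ i → Admissible (X i) (Y i) (c₁ i) (c₂ i)
  adm i = record
    { c₁≤∣X∣ = proj₂ (c₁-bounds i) ; c₂≤∣Y∣ = proj₂ (c₂-bounds i) ; 16∣X∣≤c₁c₂ = 16∣X∣≤c₁c₂ i }
  room : ∀ i → 16 * ∣ Z ∣ + D ≤ 2 * ∣ Y i ∣
  room i = begin
    16 * ∣ Z ∣ + D        ≤⟨ +-mono-≤ (16∣Z∣≤∣Y∣ i) (minᵢ≤f M (λ i → ∣ Y i ∣) i) ⟩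
    ∣ Y i ∣ + ∣ Y i ∣      ≡⟨ cong (∣ Y i ∣ +_) (+-identityʳ ∣ Y i ∣) ⟨
    2 * ∣ Y i ∣           ∎
    where open ≤-Reasoning
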